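{- Given a set $S\subseteq[n-1]$ and fixed $0\leq \ell\leq n-2$, the number of prime parking functions $\pi\in\mathrm{PPF}_n$ with $\mathrm{Set}_{\ell}(\pi)=S$ is $$|\{\pi \in \mathrm{PPF}_n : \mathrm{Set}_{\ell}(\pi)=S\}| =(n-2)^{n-1-|S|}.$$
   Context: A parking function of length $n$ is a sequence of positive integers whose increasing rearrangement $\lambda$ satisfies $\lambda_i\le i$; it is prime if removing any instance of 1 yields a parking function of length $n-1$. $\mathrm{PPF}_n$ denotes the set of prime parking functions of length $n$. A tuple $(x_1,\dots,x_n)$ has an $\ell$-forward difference at $i\in[n-1]$ if $x_{i+1}-x_i\equiv\ell\pmod{n-1}$; $\mathrm{Set}_\ell(\pi)$ is the set of indices $i$ at which $\pi$ has an $\ell$-forward difference (so $\mathrm{Set}_0(\pi)$ is the tie set). -}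

module Defs where

open import Data.Nat using (ℕ; zero; suc; _+_; _≤_; _%_)
open import Data.Nat.Properties using (≤-decTotalOrder; _≟_)
open import Data.Fin using (Fin; toℕ; inject₁) renaming (suc to fsuc)
open import Data.List using (List; length; lookup; removeAt)
open import Data.List.Relation.Unary.All using (All)
open import Data.List.Sort ≤-decTotalOrder using (sort)
open import Data.Vec using (Vec; tabulate) renaming (lookup to vlookup)
open import Data.Fin.Subset using (Subset)
open import Data.Product using (_×_)
open import Relation.Binary.PropositionalEquality using (_≡_)
open import Relation.Nullary.Decidable using (does)

IsParkingFunction : List ℕ → Set
IsParkingFunction xs =
  All (1 ≤_) xs ×
  ((i : Fin (length (sort xs))) → lookup (sort xs) i ≤ suc (toℕ i))

IsPrimeParkingFunction : List ℕ → Set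
IsPrimeParkingFunction xs =
  IsParkingFunction xs ×
  ((i : Fin (length xs)) → lookup xs i ≡ 1 → IsParkingFunction (removeAt xs i))

-- For a tuple x of length n = k + 2 (so n - 1 = suc k), Set_ℓ(x) ⊆ [n-1],
-- represented as a Subset (suc k); index i : Fin (suc k) stands for i+1 ∈ [n-1].
-- i ∈ Set_ℓ(x)  iff  x_{i+1} - x_i ≡ ℓ (mod n-1), i.e. x_{i+1} ≡ x_i + ℓ (mod n-1).
Set-ℓ : ∀ {k} → ℕ → Vec ℕ (suc (suc k)) → Subset (suc k)
Set-ℓ {k} ℓ x = tabulate λ i →
  does ((vlookup x (fsuc i) % suc k) ≟ ((vlookup x (inject₁ i) + ℓ) % suc k))

{-# OPTIONS --safe #-}

-- Write m = n − 1.  Subtracting 1 from every entry and rotating the values modulo m,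
-- z ↦ (z − c) mod m, relates PPF_n to vectors e ∈ [0, m)ⁿ, and such rotations do not
-- change Set_ℓ.  In counting form, the rotation of e that starts at c is a prime
-- parking function exactly when c is the last minimiser of j ↦ #{i : e_i < j} − j on
-- [0, m] (a cycle lemma); as this function is 0 at j = 0 and 1 at j = m, such a c
-- exists, is unique, and is below m.  Hence PPF_n ∩ {Set_ℓ = S} is in bijection with
-- the vectors e ∈ [0, m)ⁿ with e₁ = 0 whose ℓ-forward differences occur exactly on S:
-- each step in S is forced and each other step has m − 1 choices.

module Submission where

open import Defs
open import Data.Bool using (Bool; true; false; if_then_else_)
open import Data.Fin using (Fin; toℕ; fromℕ<; inject₁) renaming (zero to fzero; suc to fsuc)
open import Data.Fin.Properties using (toℕ<n; toℕ-fromℕ<)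
open import Data.Fin.Subset using (Subset; ∣_∣)
open import Data.Fin.Subset.Properties using (∣p∣≤n)
open import Data.List using (List; []; _∷_; length; lookup; removeAt; map; filter; concatMap; upTo)
open import Data.List.Properties
  using (length-map; length-++; length-upTo; length-removeAt′; map-∘; map-id-local; length-filter;
         filter-all; filter-complete; filter-none; filter-accept; filter-reject)
open import Data.List.Membership.Propositional using (_∈_; find; lose)
open import Data.List.Membership.Propositional.Properties
  using (∈-lookup; ∈-map⁺; ∈-map⁻; ∈-concatMap⁺; ∈-concatMap⁻; ∈-filter⁺; ∈-filter⁻; ∈-upTo⁺; ∈-upTo⁻)
open import Data.List.Relation.Binary.Disjoint.Propositional using (Disjoint)
open import Data.List.Relation.Binary.Permutation.Propositional using (_↭_)
open import Data.List.Relation.Binary.Permutation.Propositional.Properties using (↭-length; filter-↭)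
open import Data.List.Relation.Unary.All as All using (All; []; _∷_)
open import Data.List.Relation.Unary.All.Properties using (all-filter) renaming (map⁺ to All-map⁺)
open import Data.List.Relation.Unary.AllPairs as AllPairs using (AllPairs; []; _∷_)
import Data.List.Relation.Unary.AllPairs.Properties as AllPairs
open import Data.List.Relation.Unary.Any as Any using (Any; here; there)
open import Data.List.Relation.Unary.Any.Properties using (lookup-index)
open import Data.List.Relation.Unary.Linked.Properties using (Linked⇒AllPairs)
open import Data.List.Relation.Unary.Unique.Propositional using (Unique)
import Data.List.Relation.Unary.Unique.Propositional.Properties as Unique
open import Data.Nat
  using (ℕ; zero; suc; pred; _+_; _*_; _^_; _∸_; _≤_; _<_; z≤n; s≤s; s≤s⁻¹; z<s; _<?_; NonZero)
open import Data.Nat.DivMod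
open import Data.Nat.Properties
open import Data.Nat.Tactic.RingSolver using (solve-∀)
open import Data.List.Sort ≤-decTotalOrder using (sort; sort-↭; sort-↗)
open import Data.Product using (Σ; _×_; _,_; proj₁; proj₂; ∃-syntax)
open import Data.Sum using (_⊎_; inj₁; inj₂)
open import Data.Vec as Vec using (Vec; []; _∷_; head; tail; tabulate; toList)
import Data.Vec.Properties as Vec
open import Data.Vec.Relation.Unary.All as VecAll using ([]; _∷_)
import Data.Vec.Relation.Unary.All.Properties as VecAll
open import Function using (_∘_)
open import Function.Bundles using (_⇔_; mk⇔; Equivalence)
open import Relation.Binary.Definitions using (DecidableEquality; tri<; tri≈; tri>)
open import Relation.Binary.PropositionalEquality
  using (_≡_; _≢_; refl; sym; trans; cong; cong₂; subst; subst₂; module ≡-Reasoning)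
open import Relation.Nullary using (¬_; ¬?; Dec; yes; no; does; contradiction)
open import Relation.Nullary.Decidable using (dec-true; dec-false; does-⇔)

open Equivalence using (to; from)

count< : ℕ → List ℕ → ℕ
count< j xs = length (filter (_<? j) xs)

count<-↭ : ∀ j {xs ys} → xs ↭ ys → count< j xs ≡ count< j ys
count<-↭ j p = ↭-length (filter-↭ (_<? j) p)

count<-zero : ∀ xs → count< 0 xs ≡ 0
count<-zero xs = cong length (filter-none (_<? 0) (All.universal (λ _ ()) xs))

count<-all : ∀ {j xs} → All (_< j) xs → count< j xs ≡ length xs
count<-all {j} all = cong length (filter-all (_<? j) all)

count<-full : ∀ {j} xs → length xs ≤ count< j xs → All (_< j) xs
count<-full {j} xs h =
  subst (All (_< j)) (filter-complete (_<? j) (≤-antisym (length-filter (_<? j) xs) h)) (all-filter (_<? j) xs)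

count<-accept : ∀ {j x} xs → x < j → count< j (x ∷ xs) ≡ suc (count< j xs)
count<-accept {j} xs x<j = cong length (filter-accept (_<? j) x<j)

count<-reject : ∀ {j x} xs → ¬ x < j → count< j (x ∷ xs) ≡ count< j xs
count<-reject {j} xs x≮j = cong length (filter-reject (_<? j) x≮j)

count<-removeAt : ∀ {j} xs (i : Fin (length xs)) → lookup xs i < j →
                  count< j xs ≡ suc (count< j (removeAt xs i))
count<-removeAt (x ∷ xs) fzero x<j = count<-accept xs x<j
count<-removeAt {j} (x ∷ xs) (fsuc i) lookup<j with x <? j
... | yes x<j = trans (count<-accept xs x<j)
                      (cong suc (trans (count<-removeAt xs i lookup<j) (sym (count<-accept _ x<j))))
... | no x≮j = trans (count<-reject xs x≮j)
                     (trans (count<-removeAt xs i lookup<j) (cong suc (sym (count<-reject _ x≮j))))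

count<-pos : ∀ {j} xs → 0 < count< j xs → Any (_< j) xs
count<-pos {j} (x ∷ xs) pos with x <? j
... | yes x<j = here x<j
... | no x≮j = there (count<-pos xs (subst (0 <_) (count<-reject xs x≮j) pos))

removeAt⁺ : ∀ {P : ℕ → Set} {xs} → All P xs → (i : Fin (length xs)) → All P (removeAt xs i)
removeAt⁺ (_ ∷ ps) fzero = ps
removeAt⁺ (p ∷ ps) (fsuc i) = p ∷ removeAt⁺ ps i

-- Parking functions in counting form

sorted-lookup<⇔ : ∀ {j s} → AllPairs _≤_ s → (i : Fin (length s)) →
                  lookup s i < j ⇔ suc (toℕ i) ≤ count< j s
sorted-lookup<⇔ {j} {x ∷ s} (x≤s ∷ sorted) i with x <? j
... | yes x<j = subst (λ c → lookup (x ∷ s) i < j ⇔ suc (toℕ i) ≤ c) (sym (count<-accept s x<j)) (shifted i)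
  where
  shifted : ∀ i → lookup (x ∷ s) i < j ⇔ suc (toℕ i) ≤ suc (count< j s)
  shifted fzero = mk⇔ (λ _ → s≤s z≤n) (λ _ → x<j)
  shifted (fsuc i) = mk⇔ (s≤s ∘ to (sorted-lookup<⇔ sorted i)) (from (sorted-lookup<⇔ sorted i) ∘ s≤s⁻¹)
... | no x≮j =
  mk⇔ (λ lookup<j → contradiction (≤-<-trans (x≤lookup i) lookup<j) x≮j)
      (λ i<count → contradiction (subst (suc (toℕ i) ≤_) none i<count) λ ())
  where
  x≤lookup : ∀ i → x ≤ lookup (x ∷ s) i
  x≤lookup fzero = ≤-refl
  x≤lookup (fsuc i) = All.lookup x≤s (∈-lookup i)
  none : count< j (x ∷ s) ≡ 0
  none = cong length (filter-none (_<? j) (x≮j ∷ All.map (λ x≤y → ≤⇒≯ (≤-trans (≮⇒≥ x≮j) x≤y)) x≤s))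

ParkingCounts : List ℕ → Set
ParkingCounts xs = ∀ t → t < length xs → suc t ≤ count< (2 + t) xs

length-sort : ∀ xs → length (sort xs) ≡ length xs
length-sort xs = ↭-length (sort-↭ xs)

sort-lookup≤⇔ : ∀ xs (i : Fin (length (sort xs))) →
                lookup (sort xs) i ≤ suc (toℕ i) ⇔ suc (toℕ i) ≤ count< (2 + toℕ i) xs
sort-lookup≤⇔ xs i = mk⇔
  (λ h → subst (suc (toℕ i) ≤_) (count<-↭ _ (sort-↭ xs)) (to lookup<⇔ (s≤s h)))
  (λ h → s≤s⁻¹ (from lookup<⇔ (subst (suc (toℕ i) ≤_) (sym (count<-↭ _ (sort-↭ xs))) h)))
  where lookup<⇔ = sorted-lookup<⇔ (Linked⇒AllPairs ≤-trans (sort-↗ xs)) i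

parking⇔counts : ∀ xs → IsParkingFunction xs ⇔ (All (1 ≤_) xs × ParkingCounts xs)
parking⇔counts xs = mk⇔
  (λ (pos , sorted≤) → pos , λ t t<len →
     let i = fromℕ< (subst (t <_) (sym (length-sort xs)) t<len) in
     subst (λ u → suc u ≤ count< (2 + u) xs) (toℕ-fromℕ< _) (to (sort-lookup≤⇔ xs i) (sorted≤ i)))
  (λ (pos , parks) → pos , λ i →
     from (sort-lookup≤⇔ xs i) (parks (toℕ i) (subst (toℕ i <_) (length-sort xs) (toℕ<n i))))

count<-removeOne : ∀ xs (i : Fin (length xs)) → lookup xs i ≡ 1 →
                   ∀ t → count< (2 + t) xs ≡ suc (count< (2 + t) (removeAt xs i))
count<-removeOne xs i lookup≡1 t = count<-removeAt xs i (subst (_< 2 + t) (sym lookup≡1) (s≤s (s≤s z≤n)))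

PrimeParkingCounts : ℕ → List ℕ → Set
PrimeParkingCounts k xs = ∀ t → t ≤ k → 2 + t ≤ count< (2 + t) xs

primeCounts⇒bounded : ∀ {k xs} → length xs ≡ 2 + k → PrimeParkingCounts k xs → All (_< 2 + k) xs
primeCounts⇒bounded {k} {xs} len parks = count<-full xs (subst (_≤ count< (2 + k) xs) (sym len) (parks k ≤-refl))

prime⇒primeCounts : ∀ {k xs} → length xs ≡ 2 + k → IsPrimeParkingFunction xs → PrimeParkingCounts k xs
prime⇒primeCounts {k} {xs} len (pf , removable) t t≤k =
  subst (2 + t ≤_) (sym (count<-removeOne xs i lookup≡1 t)) (s≤s (parks′ t (subst (t <_) (sym len′) (s≤s t≤k))))
  where
  pos = proj₁ (to (parking⇔counts xs) pf)
  one : Any (_< 2) xs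
  one = count<-pos xs (proj₂ (to (parking⇔counts xs) pf) 0 (subst (0 <_) (sym len) (s≤s z≤n)))
  i = Any.index one
  lookup≡1 : lookup xs i ≡ 1
  lookup≡1 = ≤-antisym (s≤s⁻¹ (lookup-index one)) (All.lookup pos (∈-lookup i))
  parks′ = proj₂ (to (parking⇔counts _) (removable i lookup≡1))
  len′ : length (removeAt xs i) ≡ suc k
  len′ = suc-injective (trans (sym (length-removeAt′ xs i)) len)

primeCounts⇒prime : ∀ {k xs} → length xs ≡ 2 + k → All (1 ≤_) xs → PrimeParkingCounts k xs →
                    IsPrimeParkingFunction xs
primeCounts⇒prime {k} {xs} len pos parks = from (parking⇔counts xs) (pos , parks-xs) , removable
  where
  parks-xs : ParkingCounts xs
  parks-xs t t<len with m≤n⇒m<n∨m≡n (s≤s⁻¹ (subst (t <_) len t<len))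
  ... | inj₁ t<1+k = ≤-trans (n≤1+n _) (parks t (s≤s⁻¹ t<1+k))
  ... | inj₂ refl =
    ≤-reflexive (sym (trans (count<-all {xs = xs} (All.map m<n⇒m<1+n (primeCounts⇒bounded len parks))) len))
  removable : (i : Fin (length xs)) → lookup xs i ≡ 1 → IsParkingFunction (removeAt xs i)
  removable i lookup≡1 = from (parking⇔counts _) (removeAt⁺ pos i , λ t t<len′ →
    s≤s⁻¹ (subst (2 + t ≤_) (count<-removeOne xs i lookup≡1 t)
      (parks t (s≤s⁻¹ (subst (t <_) (suc-injective (trans (sym (length-removeAt′ xs i)) len)) t<len′)))))

𝟙[_<_] : ℕ → ℕ → ℕ
𝟙[ z < j ] = if does (z <? j) then 1 else 0

count<-∷ : ∀ j z zs → count< j (z ∷ zs) ≡ 𝟙[ z < j ] + count< j zs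
count<-∷ j z zs with does (z <? j)
... | true = refl
... | false = refl

𝟙-yes : ∀ {z j} → z < j → 𝟙[ z < j ] ≡ 1
𝟙-yes z<j = cong (if_then 1 else 0) (dec-true (_ <? _) z<j)

𝟙-no : ∀ {z j} → ¬ z < j → 𝟙[ z < j ] ≡ 0
𝟙-no z≮j = cong (if_then 1 else 0) (dec-false (_ <? _) z≮j)

𝟙-cong : ∀ {z j z′ j′} → (z < j ⇔ z′ < j′) → 𝟙[ z < j ] ≡ 𝟙[ z′ < j′ ]
𝟙-cong e = cong (if_then 1 else 0) (does-⇔ e (_ <? _) (_ <? _))

count<-linear : ∀ (f : ℕ → ℕ) {a b c d} zs →
                All (λ z → 𝟙[ f z < a ] + 𝟙[ z < b ] ≡ 𝟙[ z < c ] + 𝟙[ z < d ]) zs →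
                count< a (map f zs) + count< b zs ≡ count< c zs + count< d zs
count<-linear f [] [] = refl
count<-linear f {a} {b} {c} {d} (z ∷ zs) (pointwise ∷ rest) = begin
  count< a (map f (z ∷ zs)) + count< b (z ∷ zs)
    ≡⟨ cong₂ _+_ (count<-∷ a (f z) (map f zs)) (count<-∷ b z zs) ⟩
  (𝟙[ f z < a ] + count< a (map f zs)) + (𝟙[ z < b ] + count< b zs)
    ≡⟨ interchange 𝟙[ f z < a ] (count< a (map f zs)) 𝟙[ z < b ] (count< b zs) ⟩
  (𝟙[ f z < a ] + 𝟙[ z < b ]) + (count< a (map f zs) + count< b zs)
    ≡⟨ cong₂ _+_ pointwise (count<-linear f zs rest) ⟩
  (𝟙[ z < c ] + 𝟙[ z < d ]) + (count< c zs + count< d zs)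
    ≡⟨ interchange 𝟙[ z < c ] 𝟙[ z < d ] (count< c zs) (count< d zs) ⟩
  (𝟙[ z < c ] + count< c zs) + (𝟙[ z < d ] + count< d zs)
    ≡⟨ cong₂ _+_ (count<-∷ c z zs) (count<-∷ d z zs) ⟨
  count< c (z ∷ zs) + count< d (z ∷ zs) ∎
  where
  open ≡-Reasoning
  interchange : ∀ p q r s → (p + q) + (r + s) ≡ (p + r) + (q + s)
  interchange = solve-∀

𝟙-shift : ∀ {a b c d z j} → a + c ≡ d + z → c + b ≡ d + j → 𝟙[ suc a < suc b ] ≡ 𝟙[ z < j ]
𝟙-shift {a} {b} {c} {d} {z} {j} a+c≡d+z c+b≡d+j = 𝟙-cong (mk⇔
  (λ a<b → +-cancelˡ-< d z j
     (subst₂ _<_ a+c≡d+z c+b≡d+j (subst (a + c <_) (+-comm b c) (+-monoˡ-< c (s≤s⁻¹ a<b)))))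
  (λ z<j → s≤s (+-cancelʳ-< c a b
     (subst₂ _<_ (sym a+c≡d+z) (trans (sym c+b≡d+j) (+-comm c b)) (+-monoʳ-< d z<j)))))

IsLastArgmin : (ℕ → ℕ) → ℕ → ℕ → Set
IsLastArgmin g n c = (∀ j → j < c → g c ≤ g j) × (∀ j → c < j → j ≤ n → g c < g j)

lastArgmin : ∀ g n → ∃[ c ] c ≤ n × IsLastArgmin g n c
lastArgmin g zero = 0 , z≤n , (λ _ ()) , λ j 0<j j≤0 → contradiction j≤0 (<⇒≱ 0<j)
lastArgmin g (suc n) with lastArgmin g n
... | c , c≤n , before , after with g (suc n) ≤? g c
...   | yes last≤c = suc n , ≤-refl , before′ , λ j n<j j≤n → contradiction j≤n (<⇒≱ n<j)
  where
  before′ : ∀ j → j < suc n → g (suc n) ≤ g j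
  before′ j j<1+n with <-cmp j c
  ... | tri< j<c _ _ = ≤-trans last≤c (before j j<c)
  ... | tri≈ _ refl _ = last≤c
  ... | tri> _ _ c<j = ≤-trans last≤c (<⇒≤ (after j c<j (s≤s⁻¹ j<1+n)))
...   | no last≰c = c , m≤n⇒m≤1+n c≤n , before , after′
  where
  after′ : ∀ j → c < j → j ≤ suc n → g c < g j
  after′ j c<j j≤1+n with m≤n⇒m<n∨m≡n j≤1+n
  ... | inj₁ j<1+n = after j c<j (s≤s⁻¹ j<1+n)
  ... | inj₂ refl = ≰⇒> last≰c

-- c is the last minimiser of j ↦ f j − j on [0, n], stated without subtraction.
IsLastMinimiser : (ℕ → ℕ) → ℕ → ℕ → Set
IsLastMinimiser f n c = (∀ j → j < c → f c + j ≤ f j + c) × (∀ j → c < j → j ≤ n → f c + j < f j + c)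

lastMinimiser-unique : ∀ {f n c c′} → c ≤ n → c′ ≤ n →
                       IsLastMinimiser f n c → IsLastMinimiser f n c′ → c ≡ c′
lastMinimiser-unique {c = c} {c′} c≤n c′≤n (before , after) (before′ , after′) with <-cmp c c′
... | tri< c<c′ _ _ = contradiction (before′ c c<c′) (<⇒≱ (after c′ c<c′ c′≤n))
... | tri≈ _ c≡c′ _ = c≡c′
... | tri> _ _ c′<c = contradiction (before c′ c′<c) (<⇒≱ (after′ c c′<c c≤n))

excess-≤ : ∀ {a b c j n} → c ≤ n → j ≤ n → a + (n ∸ c) ≤ b + (n ∸ j) → a + j ≤ b + c
excess-≤ {a} {b} {c} {j} {n} c≤n j≤n h = +-cancelʳ-≤ n (a + j) (b + c) (begin
  a + j + n                  ≡⟨ cong (a + j +_) (m∸n+n≡m c≤n) ⟨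
  a + j + (n ∸ c + c)        ≡⟨ shuffleˡ a j (n ∸ c) c ⟩
  a + (n ∸ c) + (c + j)      ≤⟨ +-monoˡ-≤ (c + j) h ⟩
  b + (n ∸ j) + (c + j)      ≡⟨ shuffleʳ b c (n ∸ j) j ⟩
  b + c + (n ∸ j + j)        ≡⟨ cong (b + c +_) (m∸n+n≡m j≤n) ⟩
  b + c + n                  ∎)
  where
  open ≤-Reasoning
  shuffleˡ : ∀ a j d c → a + j + (d + c) ≡ a + d + (c + j)
  shuffleˡ = solve-∀
  shuffleʳ : ∀ b c d j → b + d + (c + j) ≡ b + c + (d + j)
  shuffleʳ = solve-∀

lastMinimiser : ∀ f n → ∃[ c ] c ≤ n × IsLastMinimiser f n c
lastMinimiser f n with lastArgmin (λ j → f j + (n ∸ j)) n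
... | c , c≤n , before , after =
  c , c≤n , (λ j j<c → excess-≤ c≤n (≤-trans (<⇒≤ j<c) c≤n) (before j j<c))
          , (λ j c<j j≤n → excess-≤ c≤n j≤n (after j c<j j≤n))

-- Rotations modulo m

module Rotation (m : ℕ) .{{_ : NonZero m}} where

  %-absorbˡ : ∀ a b → (a % m + b) % m ≡ (a + b) % m
  %-absorbˡ a b = begin
    (a % m + b) % m          ≡⟨ %-distribˡ-+ (a % m) b m ⟩
    (a % m % m + b % m) % m  ≡⟨ cong (λ x → (x + b % m) % m) (m%n%n≡m%n a m) ⟩
    (a % m + b % m) % m      ≡⟨ %-distribˡ-+ a b m ⟨
    (a + b) % m              ∎
    where open ≡-Reasoning

  %-+-period : ∀ a K → (a + K + (m ∸ K % m)) % m ≡ a % m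
  %-+-period a K = begin
    (a + K + (m ∸ K % m)) % m   ≡⟨ cong (_% m) (+-assoc a K _) ⟩
    (a + (K + (m ∸ K % m))) % m ≡⟨ cong (λ x → (a + x) % m) K+complement ⟩
    (a + suc (K / m) * m) % m   ≡⟨ [m+kn]%n≡m%n a (suc (K / m)) m ⟩
    a % m                       ∎
    where
    open ≡-Reasoning
    K+complement : K + (m ∸ K % m) ≡ suc (K / m) * m
    K+complement = begin
      K + (m ∸ K % m)                     ≡⟨ cong (_+ (m ∸ K % m)) (m≡m%n+[m/n]*n K m) ⟩
      K % m + K / m * m + (m ∸ K % m)     ≡⟨ shuffle (K % m) (K / m * m) (m ∸ K % m) ⟩
      (K % m + (m ∸ K % m)) + K / m * m   ≡⟨ cong (_+ K / m * m) (m+[n∸m]≡n (m%n≤n K m)) ⟩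
      m + K / m * m                       ∎
      where
      shuffle : ∀ a b c → a + b + c ≡ (a + c) + b
      shuffle = solve-∀

  +-%-⇔ : ∀ {a b} K → (a + K) % m ≡ (b + K) % m ⇔ a % m ≡ b % m
  +-%-⇔ {a} {b} K = mk⇔
    (λ e → trans (sym (%-+-period a K)) (trans (cong-+ (m ∸ K % m) e) (%-+-period b K)))
    (cong-+ K)
    where
    cong-+ : ∀ {a b} K → a % m ≡ b % m → (a + K) % m ≡ (b + K) % m
    cong-+ {a} {b} K e = trans (sym (%-absorbˡ a K)) (trans (cong (λ x → (x + K) % m) e) (%-absorbˡ b K))

  rotate : ℕ → ℕ → ℕ
  rotate c z = (z + (m ∸ c)) % m

  rotate<m : ∀ c z → rotate c z < m
  rotate<m c z = m%n<n _ m

  rotate-zero : ∀ {z} → z < m → rotate 0 z ≡ z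
  rotate-zero {z} z<m = trans ([m+n]%n≡m%n z m) (m<n⇒m%n≡m z<m)

  rotate-self : ∀ {c} → c ≤ m → rotate c c ≡ 0
  rotate-self c≤m = trans (cong (_% m) (m+[n∸m]≡n c≤m)) (n%n≡0 m)

  rotate-+-≥ : ∀ {c z} → c ≤ z → z < m → rotate c z + c ≡ z
  rotate-+-≥ {c} {z} c≤z z<m = begin
    rotate c z + c               ≡⟨ cong (λ x → (x + (m ∸ c)) % m + c) (m∸n+n≡m c≤z) ⟨
    (z ∸ c + c + (m ∸ c)) % m + c ≡⟨ cong (λ x → x % m + c) (+-assoc (z ∸ c) c (m ∸ c)) ⟩
    (z ∸ c + (c + (m ∸ c))) % m + c ≡⟨ cong (λ x → (z ∸ c + x) % m + c) (m+[n∸m]≡n c≤m) ⟩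
    (z ∸ c + m) % m + c          ≡⟨ cong (_+ c) (rotate-zero (≤-<-trans (m∸n≤m z c) z<m)) ⟩
    z ∸ c + c                    ≡⟨ m∸n+n≡m c≤z ⟩
    z                            ∎
    where
    open ≡-Reasoning
    c≤m = ≤-trans c≤z (<⇒≤ z<m)

  rotate-+-< : ∀ {c z} → z < c → c ≤ m → rotate c z + c ≡ z + m
  rotate-+-< {c} {z} z<c c≤m = begin
    rotate c z + c       ≡⟨ cong (_+ c) (m<n⇒m%n≡m shifted<m) ⟩
    z + (m ∸ c) + c      ≡⟨ +-assoc z (m ∸ c) c ⟩
    z + (m ∸ c + c)      ≡⟨ cong (z +_) (m∸n+n≡m c≤m) ⟩
    z + m                ∎
    where
    open ≡-Reasoning
    shifted<m : z + (m ∸ c) < m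
    shifted<m = subst (z + (m ∸ c) <_) (m+[n∸m]≡n c≤m) (+-monoˡ-< (m ∸ c) z<c)

  rotate-inverse : ∀ {a z} → a < m → z < m → rotate ((m ∸ a) % m) (rotate a z) ≡ z
  rotate-inverse {zero} {z} _ z<m =
    trans (cong (λ c → rotate c (rotate 0 z)) (n%n≡0 m)) (trans (rotate-zero (rotate<m 0 z)) (rotate-zero z<m))
  rotate-inverse {a@(suc _)} {z} a<m z<m = begin
    rotate ((m ∸ a) % m) (rotate a z)        ≡⟨ cong (λ c → rotate c (rotate a z)) (m<n⇒m%n≡m m∸a<m) ⟩
    ((z + (m ∸ a)) % m + (m ∸ (m ∸ a))) % m  ≡⟨ cong (λ x → ((z + (m ∸ a)) % m + x) % m) (m∸[m∸n]≡n a≤m) ⟩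
    ((z + (m ∸ a)) % m + a) % m              ≡⟨ %-absorbˡ (z + (m ∸ a)) a ⟩
    (z + (m ∸ a) + a) % m                    ≡⟨ cong (_% m) (+-assoc z (m ∸ a) a) ⟩
    (z + (m ∸ a + a)) % m                    ≡⟨ cong (λ x → (z + x) % m) (m∸n+n≡m a≤m) ⟩
    (z + m) % m                              ≡⟨ rotate-zero z<m ⟩
    z                                        ∎
    where
    open ≡-Reasoning
    a≤m = <⇒≤ a<m
    m∸a<m = ∸-monoʳ-< z<s a≤m

  suc-rotate-% : ∀ c z → suc (rotate c z) % m ≡ (z + suc (m ∸ c)) % m
  suc-rotate-% c z = begin
    (1 + (z + (m ∸ c)) % m) % m  ≡⟨ cong (_% m) (+-comm 1 _) ⟩
    ((z + (m ∸ c)) % m + 1) % m  ≡⟨ %-absorbˡ (z + (m ∸ c)) 1 ⟩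
    (z + (m ∸ c) + 1) % m        ≡⟨ cong (_% m) (+-assoc z (m ∸ c) 1) ⟩
    (z + (m ∸ c + 1)) % m        ≡⟨ cong (λ x → (z + x) % m) (+-comm (m ∸ c) 1) ⟩
    (z + suc (m ∸ c)) % m        ∎
    where open ≡-Reasoning

  forwardDiffᵇ : ℕ → ℕ → ℕ → Bool
  forwardDiffᵇ ℓ x y = does (y % m ≟ (x + ℓ) % m)

  forwardDiffᵇ-rotate : ∀ ℓ c x y → forwardDiffᵇ ℓ (suc (rotate c x)) (suc (rotate c y)) ≡ forwardDiffᵇ ℓ x y
  forwardDiffᵇ-rotate ℓ c x y = does-⇔
    (subst₂ (λ l r → l ≡ r ⇔ y % m ≡ (x + ℓ) % m) (sym (suc-rotate-% c y)) (sym rhs) (+-%-⇔ (suc (m ∸ c))))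
    (_ ≟ _) (_ ≟ _)
    where
    open ≡-Reasoning
    rhs : (suc (rotate c x) + ℓ) % m ≡ (x + ℓ + suc (m ∸ c)) % m
    rhs = begin
      (suc (rotate c x) + ℓ) % m       ≡⟨ %-absorbˡ (suc (rotate c x)) ℓ ⟨
      (suc (rotate c x) % m + ℓ) % m   ≡⟨ cong (λ v → (v + ℓ) % m) (suc-rotate-% c x) ⟩
      ((x + suc (m ∸ c)) % m + ℓ) % m  ≡⟨ %-absorbˡ (x + suc (m ∸ c)) ℓ ⟩
      (x + suc (m ∸ c) + ℓ) % m        ≡⟨ cong (_% m) (+-assoc x (suc (m ∸ c)) ℓ) ⟩
      (x + (suc (m ∸ c) + ℓ)) % m      ≡⟨ cong (λ v → (x + v) % m) (+-comm (suc (m ∸ c)) ℓ) ⟩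
      (x + (ℓ + suc (m ∸ c))) % m      ≡⟨ cong (_% m) (+-assoc x ℓ (suc (m ∸ c))) ⟨
      (x + ℓ + suc (m ∸ c)) % m        ∎

-- The cycle lemma

<⇔<-shift : ∀ {x a b c u j} → x + a ≡ b → c + u ≡ j → u < x ⇔ a + j < b + c
<⇔<-shift {x} {a} {c = c} {u} refl refl = mk⇔
  (λ u<x → subst₂ _<_ (rearrangeˡ a c u) (rearrangeʳ a c x) (+-monoʳ-< (a + c) u<x))
  (λ h → +-cancelˡ-< (a + c) u x (subst₂ _<_ (sym (rearrangeˡ a c u)) (sym (rearrangeʳ a c x)) h))
  where
  rearrangeˡ : ∀ a c u → a + c + u ≡ a + (c + u)
  rearrangeˡ = solve-∀
  rearrangeʳ : ∀ a c x → a + c + x ≡ x + a + c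
  rearrangeʳ = solve-∀

<⇔≤-shift : ∀ {x a b c u j n} → x + a ≡ suc n + b → c + u ≡ n + j → u < x ⇔ a + j ≤ b + c
<⇔≤-shift {x} {a} {b} {c} {u} {j} {n} x+a≡ c+u≡ = mk⇔
  (λ u<x → +-cancelˡ-≤ (suc n) (a + j) (b + c) (subst₂ _≤_ lhs rhs (+-monoʳ-≤ (a + c) u<x)))
  (λ h → +-cancelˡ-≤ (a + c) (suc u) x (subst₂ _≤_ (sym lhs) (sym rhs) (+-monoʳ-≤ (suc n) h)))
  where
  open ≡-Reasoning
  lhs : a + c + suc u ≡ suc n + (a + j)
  lhs = begin
    a + c + suc u      ≡⟨ +-suc (a + c) u ⟩
    suc (a + c + u)    ≡⟨ cong suc (+-assoc a c u) ⟩
    suc (a + (c + u))  ≡⟨ cong (λ v → suc (a + v)) c+u≡ ⟩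
    suc (a + (n + j))  ≡⟨ cong suc (rearrange a n j) ⟩
    suc (n + (a + j))  ∎
    where
    rearrange : ∀ a n j → a + (n + j) ≡ n + (a + j)
    rearrange = solve-∀
  rhs : a + c + x ≡ suc n + (b + c)
  rhs = begin
    a + c + x          ≡⟨ rearrange a c x ⟩
    x + a + c          ≡⟨ cong (_+ c) x+a≡ ⟩
    suc n + b + c      ≡⟨ +-assoc (suc n) b c ⟩
    suc n + (b + c)    ∎
    where
    rearrange : ∀ a c x → a + c + x ≡ x + a + c
    rearrange = solve-∀

module CycleLemma (k : ℕ) where

  m = suc k
  open Rotation m

  𝟙-rotate-low : ∀ {c u j z} → c + u ≡ j → j ≤ m → z < m →
                 𝟙[ suc (rotate c z) < suc u ] + 𝟙[ z < c ] ≡ 𝟙[ z < j ] + 𝟙[ z < 0 ]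
  𝟙-rotate-low {c} {u} {j} {z} c+u≡j j≤m z<m with c ≤? z
  ... | yes c≤z = cong₂ _+_ (𝟙-shift {rotate c z} {u} {c} {0} (rotate-+-≥ c≤z z<m) c+u≡j)
                            (trans (𝟙-no (≤⇒≯ c≤z)) (sym (𝟙-no {z} {0} λ ())))
  ... | no c≰z = trans
    (cong₂ _+_ (trans (𝟙-shift {rotate c z} {u} {c} {0} (rotate-+-< z<c c≤m) c+u≡j)
                      (𝟙-no λ z+m<j → <⇒≱ z+m<j (≤-trans j≤m (m≤n+m m z))))
               (𝟙-yes z<c))
    (sym (cong₂ _+_ (𝟙-yes (<-≤-trans z<c c≤j)) (𝟙-no {z} {0} λ ())))
    where
    z<c = ≰⇒> c≰z
    c≤j = subst (c ≤_) c+u≡j (m≤m+n c u)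
    c≤m = ≤-trans c≤j j≤m

  𝟙-rotate-high : ∀ {c u j z} → c ≤ m → u ≤ m → c + u ≡ m + j → z < m →
                  𝟙[ suc (rotate c z) < suc u ] + 𝟙[ z < c ] ≡ 𝟙[ z < m ] + 𝟙[ z < j ]
  𝟙-rotate-high {c} {u} {j} {z} c≤m u≤m c+u≡m+j z<m with c ≤? z
  ... | yes c≤z = trans
    (cong₂ _+_ (trans (𝟙-shift {rotate c z} {u} {c} {0} (rotate-+-≥ c≤z z<m) c+u≡m+j)
                      (𝟙-yes (≤-trans z<m (m≤m+n m j))))
               (𝟙-no (≤⇒≯ c≤z)))
    (sym (cong₂ _+_ (𝟙-yes z<m) (𝟙-no (≤⇒≯ (≤-trans j≤c c≤z)))))
    where
    j≤c : j ≤ c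
    j≤c = +-cancelˡ-≤ m j c (subst₂ _≤_ c+u≡m+j (+-comm c m) (+-monoʳ-≤ c u≤m))
  ... | no c≰z = trans
    (cong₂ _+_ (𝟙-shift {rotate c z} {u} {c} {m} (trans (rotate-+-< (≰⇒> c≰z) c≤m) (+-comm z m)) c+u≡m+j)
               (𝟙-yes (≰⇒> c≰z)))
    (trans (+-comm _ 1) (cong (_+ 𝟙[ z < j ]) (sym (𝟙-yes z<m))))

  split : List ℕ → ℕ
  split es = proj₁ (lastMinimiser (λ j → count< j es) m)

  split-lastMinimiser : ∀ es → IsLastMinimiser (λ j → count< j es) m (split es)
  split-lastMinimiser es = proj₂ (proj₂ (lastMinimiser (λ j → count< j es) m))

  module _ {es} (bounded : All (_< m) es) (len : length es ≡ suc m) where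

    count-rotate-low : ∀ {c u j} → c + u ≡ j → j ≤ m →
                       count< (suc u) (map (suc ∘ rotate c) es) + count< c es ≡ count< j es
    count-rotate-low {c} {u} {j} c+u≡j j≤m = begin
      count< (suc u) (map (suc ∘ rotate c) es) + count< c es
        ≡⟨ count<-linear (suc ∘ rotate c) es (All.map (𝟙-rotate-low {c} {u} c+u≡j j≤m) bounded) ⟩
      count< j es + count< 0 es  ≡⟨ cong (count< j es +_) (count<-zero es) ⟩
      count< j es + 0            ≡⟨ +-identityʳ _ ⟩
      count< j es                ∎
      where open ≡-Reasoning

    count-rotate-high : ∀ {c u j} → c ≤ m → u ≤ m → c + u ≡ m + j →
                        count< (suc u) (map (suc ∘ rotate c) es) + count< c es ≡ suc m + count< j es
    count-rotate-high {c} {u} {j} c≤m u≤m c+u≡m+j =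
      trans (count<-linear (suc ∘ rotate c) es (All.map (𝟙-rotate-high {c} {u} c≤m u≤m c+u≡m+j) bounded))
            (cong (_+ count< j es) (trans (count<-all bounded) len))

    rotated-low⇔ : ∀ {c u j} → c + u ≡ j → j ≤ m →
                   u < count< (suc u) (map (suc ∘ rotate c) es) ⇔ count< c es + j < count< j es + c
    rotated-low⇔ c+u≡j j≤m = <⇔<-shift (count-rotate-low c+u≡j j≤m) c+u≡j

    rotated-high⇔ : ∀ {c u j} → c ≤ m → u ≤ m → c + u ≡ m + j →
                    u < count< (suc u) (map (suc ∘ rotate c) es) ⇔ count< c es + j ≤ count< j es + c
    rotated-high⇔ c≤m u≤m c+u≡m+j = <⇔≤-shift (count-rotate-high c≤m u≤m c+u≡m+j) c+u≡m+j

    primeCounts⇒lastMinimiser : ∀ {c} → c < m → PrimeParkingCounts k (map (suc ∘ rotate c) es) →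
                                IsLastMinimiser (λ j → count< j es) m c
    primeCounts⇒lastMinimiser {c} c<m counts = before , after
      where
      before : ∀ j → j < c → count< c es + j ≤ count< j es + c
      before j j<c with m≤n⇒∃[o]m+o≡n c<m
      ... | d , 1+c+d≡m = to (rotated-high⇔ (<⇒≤ c<m) (s≤s d+j≤k) c+u≡m+j) (counts (d + j) d+j≤k)
        where
        d+j≤k : d + j ≤ k
        d+j≤k = subst (d + j ≤_) (trans (+-comm d c) (suc-injective 1+c+d≡m)) (+-monoʳ-≤ d (<⇒≤ j<c))
        rearrange : ∀ c d j → c + suc (d + j) ≡ suc c + d + j
        rearrange = solve-∀
        c+u≡m+j : c + suc (d + j) ≡ m + j
        c+u≡m+j = trans (rearrange c d j) (cong (_+ j) 1+c+d≡m)
      after : ∀ j → c < j → j ≤ m → count< c es + j < count< j es + c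
      after j c<j j≤m with m≤n⇒∃[o]m+o≡n c<j
      ... | t , 1+c+t≡j = to (rotated-low⇔ (trans (+-suc c t) 1+c+t≡j) j≤m) (counts t t≤k)
        where
        t≤k : t ≤ k
        t≤k = ≤-trans (m≤n+m t c) (s≤s⁻¹ (subst (_≤ m) (sym 1+c+t≡j) j≤m))

    lastMinimiser⇒primeCounts : ∀ {c} → c < m → IsLastMinimiser (λ j → count< j es) m c →
                                PrimeParkingCounts k (map (suc ∘ rotate c) es)
    lastMinimiser⇒primeCounts {c} c<m (before , after) t t≤k with c + suc t ≤? m
    ... | yes c+u≤m = from (rotated-low⇔ refl c+u≤m) (after (c + suc t) (m<m+n c z<s) c+u≤m)
    ... | no c+u≰m with m≤n⇒∃[o]m+o≡n (<⇒≤ (≰⇒> c+u≰m))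
    ...   | j , m+j≡c+u =
      from (rotated-high⇔ (<⇒≤ c<m) (s≤s t≤k) (sym m+j≡c+u)) (atMost (m≤n⇒m<n∨m≡n j≤c))
      where
      j≤c : j ≤ c
      j≤c = +-cancelˡ-≤ m j c (subst₂ _≤_ (sym m+j≡c+u) (+-comm c m) (+-monoʳ-≤ c (s≤s t≤k)))
      atMost : j < c ⊎ j ≡ c → count< c es + j ≤ count< j es + c
      atMost (inj₁ j<c) = before j j<c
      atMost (inj₂ refl) = ≤-refl

    rotation-prime⇔ : ∀ {c} → c < m →
                      IsPrimeParkingFunction (map (suc ∘ rotate c) es) ⇔ IsLastMinimiser (λ j → count< j es) m c
    rotation-prime⇔ {c} c<m = mk⇔
      (primeCounts⇒lastMinimiser c<m ∘ prime⇒primeCounts len′)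
      (primeCounts⇒prime len′ (All-map⁺ (All.universal (λ _ → s≤s z≤n) es)) ∘ lastMinimiser⇒primeCounts c<m)
      where
      len′ : length (map (suc ∘ rotate c) es) ≡ 2 + k
      len′ = trans (length-map _ es) len

    split<m : split es < m
    split<m = ≤∧≢⇒< (proj₁ (proj₂ (lastMinimiser (λ j → count< j es) m))) λ split≡m →
      n≮n m (subst₂ _≤_ count<m count<0
        (subst (λ c → count< c es + 0 ≤ count< 0 es + c) split≡m
          (proj₁ (split-lastMinimiser es) 0 (subst (0 <_) (sym split≡m) z<s))))
      where
      count<m : count< m es + 0 ≡ suc m
      count<m = trans (+-identityʳ _) (trans (count<-all bounded) len)
      count<0 : count< 0 es + m ≡ m
      count<0 = cong (_+ m) (count<-zero es)

    split-prime : IsPrimeParkingFunction (map (suc ∘ rotate (split es)) es)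
    split-prime = from (rotation-prime⇔ split<m) (split-lastMinimiser es)

    prime⇒split : ∀ {c} → c < m → IsPrimeParkingFunction (map (suc ∘ rotate c) es) → split es ≡ c
    prime⇒split c<m prime =
      lastMinimiser-unique (<⇒≤ split<m) (<⇒≤ c<m) (split-lastMinimiser es) (to (rotation-prime⇔ c<m) prime)

adjacent : ∀ {A B : Set} {j} → (A → A → B) → Vec A (suc j) → Vec B j
adjacent f (x ∷ []) = []
adjacent f (x ∷ y ∷ v) = f x y ∷ adjacent f (y ∷ v)

tabulate-adjacent : ∀ {A B : Set} {j} (f : A → A → B) (v : Vec A (suc j)) →
                    tabulate (λ i → f (Vec.lookup v (inject₁ i)) (Vec.lookup v (fsuc i))) ≡ adjacent f v
tabulate-adjacent f (x ∷ []) = refl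
tabulate-adjacent f (x ∷ y ∷ v) = cong (f x y ∷_) (tabulate-adjacent f (y ∷ v))

adjacent-map : ∀ {A B : Set} {j} {f : A → A → B} {g : A → A} → (∀ x y → f (g x) (g y) ≡ f x y) →
               (v : Vec A (suc j)) → adjacent f (Vec.map g v) ≡ adjacent f v
adjacent-map f∘g≡f (x ∷ []) = refl
adjacent-map f∘g≡f (x ∷ y ∷ v) = cong₂ _∷_ (f∘g≡f x y) (adjacent-map f∘g≡f (y ∷ v))

map-id-localᵛ : ∀ {A : Set} {n} {f : A → A} {v : Vec A n} → VecAll.All (λ x → f x ≡ x) v → Vec.map f v ≡ v
map-id-localᵛ [] = refl
map-id-localᵛ (fx≡x ∷ rest) = cong₂ _∷_ fx≡x (map-id-localᵛ rest)

length-concatMap : ∀ {A B : Set} {n} (f : A → List B) → (∀ x → length (f x) ≡ n) →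
                   ∀ xs → length (concatMap f xs) ≡ length xs * n
length-concatMap f lengths [] = refl
length-concatMap f lengths (x ∷ xs) =
  trans (length-++ (f x)) (cong₂ _+_ (lengths x) (length-concatMap f lengths xs))

length-filter-≢ : ∀ {A : Set} (_≟′_ : DecidableEquality A) {xs t} → Unique xs → t ∈ xs →
                  suc (length (filter (λ y → ¬? (y ≟′ t)) xs)) ≡ length xs
length-filter-≢ _≟′_ {x ∷ xs} (x∉xs ∷ _) (here refl) =
  cong suc (trans (cong length (filter-reject (λ y → ¬? (y ≟′ x)) (λ x≢x → x≢x refl)))
                  (cong length (filter-all (λ y → ¬? (y ≟′ x)) (All.map (λ x≢y y≡x → x≢y (sym y≡x)) x∉xs))))
length-filter-≢ _≟′_ {x ∷ xs} (x∉xs ∷ unique) (there t∈xs) =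
  cong suc (trans (cong length (filter-accept (λ y → ¬? (y ≟′ _)) (All.lookup x∉xs t∈xs)))
                  (length-filter-≢ _≟′_ unique t∈xs))

module LabelledWalks {A : Set} (P : A → Set) (label : A → A → Bool) (next : A → Bool → List A)
                     (∈-next⇔ : ∀ {x s y} → y ∈ next x s ⇔ (P y × label x y ≡ s)) where

  walks : ∀ {j} → A → Subset j → List (Vec A (suc j))
  walks a [] = (a ∷ []) ∷ []
  walks a (s ∷ S) = map (a ∷_) (concatMap (λ b → walks b S) (next a s))

  ∈-walks⁻ : ∀ {j a} {S : Subset j} {v} → v ∈ walks a S →
             head v ≡ a × VecAll.All P (tail v) × adjacent label v ≡ S
  ∈-walks⁻ {S = []} {_ ∷ []} (here refl) = refl , [] , refl
  ∈-walks⁻ {a = a} {S = s ∷ S} v∈ with ∈-map⁻ (a ∷_) v∈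
  ... | y ∷ w , w∈ , refl with find (∈-concatMap⁻ (λ b → walks b S) w∈)
  ...   | b , b∈next , w∈walks with ∈-walks⁻ {a = b} {S = S} w∈walks | to ∈-next⇔ b∈next
  ...     | refl , Pw , labels | Py , label≡s = refl , Py ∷ Pw , cong₂ _∷_ label≡s labels

  ∈-walks⁺ : ∀ {j} {S : Subset j} v → VecAll.All P (tail v) → adjacent label v ≡ S → v ∈ walks (head v) S
  ∈-walks⁺ {S = []} (x ∷ []) _ _ = here refl
  ∈-walks⁺ {S = s ∷ S} (x ∷ y ∷ w) (Py ∷ Pw) labels = ∈-map⁺ (x ∷_) (∈-concatMap⁺ (λ b → walks b S)
    (lose (from ∈-next⇔ (Py , Vec.∷-injectiveˡ labels)) (∈-walks⁺ (y ∷ w) Pw (Vec.∷-injectiveʳ labels))))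

  walks-unique : (∀ x s → Unique (next x s)) → ∀ {j} a (S : Subset j) → Unique (walks a S)
  walks-unique next-unique a [] = [] ∷ []
  walks-unique next-unique a (s ∷ S) = Unique.map⁺ Vec.∷-injectiveʳ (Unique.concat⁺
    (All-map⁺ (All.universal (λ b → walks-unique next-unique b S) (next a s)))
    (AllPairs.map⁺ (AllPairs.map disjoint (next-unique a s))))
    where
    disjoint : ∀ {b b′} → b ≢ b′ → Disjoint (walks b S) (walks b′ S)
    disjoint {b} {b′} b≢b′ (v∈ , v∈′) =
      b≢b′ (trans (sym (proj₁ (∈-walks⁻ {a = b} {S = S} v∈))) (proj₁ (∈-walks⁻ {a = b′} {S = S} v∈′)))

  length-walks : ∀ {p q} → (∀ x → length (next x true) ≡ p) → (∀ x → length (next x false) ≡ q) →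
                 ∀ {j} a (S : Subset j) → length (walks a S) ≡ p ^ ∣ S ∣ * q ^ (j ∸ ∣ S ∣)
  length-walks lengthᵗ lengthᶠ a [] = refl
  length-walks {p} {q} lengthᵗ lengthᶠ {suc j} a (s ∷ S) = begin
    length (map (a ∷_) (concatMap (λ b → walks b S) (next a s)))
      ≡⟨ length-map (a ∷_) (concatMap (λ b → walks b S) (next a s)) ⟩
    length (concatMap (λ b → walks b S) (next a s))
      ≡⟨ length-concatMap (λ b → walks b S) (λ b → length-walks lengthᵗ lengthᶠ b S) (next a s) ⟩
    length (next a s) * (p ^ ∣ S ∣ * q ^ (j ∸ ∣ S ∣))
      ≡⟨ step s ⟩
    p ^ ∣ s ∷ S ∣ * q ^ (suc j ∸ ∣ s ∷ S ∣) ∎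
    where
    open ≡-Reasoning
    rearrange : ∀ a b c → a * (b * c) ≡ b * (a * c)
    rearrange = solve-∀
    step : ∀ s → length (next a s) * (p ^ ∣ S ∣ * q ^ (j ∸ ∣ S ∣)) ≡
                 p ^ ∣ s ∷ S ∣ * q ^ (suc j ∸ ∣ s ∷ S ∣)
    step true = trans (cong (_* _) (lengthᵗ a)) (sym (*-assoc p _ _))
    step false = begin
      length (next a false) * (p ^ ∣ S ∣ * q ^ (j ∸ ∣ S ∣)) ≡⟨ cong (_* _) (lengthᶠ a) ⟩
      q * (p ^ ∣ S ∣ * q ^ (j ∸ ∣ S ∣))                    ≡⟨ rearrange q (p ^ ∣ S ∣) _ ⟩
      p ^ ∣ S ∣ * q ^ suc (j ∸ ∣ S ∣)
        ≡⟨ cong (λ e → p ^ ∣ S ∣ * q ^ e) (+-∸-assoc 1 (∣p∣≤n S)) ⟨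
      p ^ ∣ S ∣ * q ^ (suc j ∸ ∣ S ∣)                       ∎

-- Enumerating PPF_n by Set_ℓ

module Enumeration (k ℓ : ℕ) where

  open CycleLemma k
  open Rotation m

  successors : ℕ → Bool → List ℕ
  successors x true = (x + ℓ) % m ∷ []
  successors x false = filter (λ y → ¬? (y ≟ (x + ℓ) % m)) (upTo m)

  ∈-successors⇔ : ∀ {x s y} → y ∈ successors x s ⇔ (y < m × forwardDiffᵇ ℓ x y ≡ s)
  ∈-successors⇔ {x} {true} {y} = mk⇔
    (λ { (here refl) → m%n<n (x + ℓ) m , dec-true (_ ≟ _) (m%n%n≡m%n (x + ℓ) m) }) from′
    where
    witness : ∀ {P : Set} (P? : Dec P) → does P? ≡ true → P
    witness (yes p) _ = p
    from′ : y < m × forwardDiffᵇ ℓ x y ≡ true → y ∈ successors x true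
    from′ (y<m , diff) = here (trans (sym (m<n⇒m%n≡m y<m)) (witness (y % m ≟ (x + ℓ) % m) diff))
  ∈-successors⇔ {x} {false} {y} = mk⇔ to′ from′
    where
    to′ : y ∈ successors x false → y < m × forwardDiffᵇ ℓ x y ≡ false
    to′ y∈ with ∈-filter⁻ (λ y → ¬? (y ≟ (x + ℓ) % m)) y∈
    ... | y∈upTo , y≢target = ∈-upTo⁻ y∈upTo ,
      dec-false (_ ≟ _) (λ y%m≡target → y≢target (trans (sym (m<n⇒m%n≡m (∈-upTo⁻ y∈upTo))) y%m≡target))
    from′ : y < m × forwardDiffᵇ ℓ x y ≡ false → y ∈ successors x false
    from′ (y<m , diff) = ∈-filter⁺ (λ y → ¬? (y ≟ (x + ℓ) % m)) (∈-upTo⁺ y<m) λ y≡target →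
      contradiction (trans (sym diff) (dec-true (_ ≟ _) (trans (m<n⇒m%n≡m y<m) y≡target))) λ ()

  successors-unique : ∀ x s → Unique (successors x s)
  successors-unique x true = [] ∷ []
  successors-unique x false = Unique.filter⁺ (λ y → ¬? (y ≟ (x + ℓ) % m)) (Unique.upTo⁺ m)

  length-successors-false : ∀ x → length (successors x false) ≡ k
  length-successors-false x =
    suc-injective (trans (length-filter-≢ _≟_ (Unique.upTo⁺ m) (∈-upTo⁺ (m%n<n (x + ℓ) m))) (length-upTo m))

  open LabelledWalks (_< m) (forwardDiffᵇ ℓ) successors ∈-successors⇔

  Set-ℓ≡adjacent : ∀ π → Set-ℓ ℓ π ≡ adjacent (forwardDiffᵇ ℓ) π
  Set-ℓ≡adjacent = tabulate-adjacent (forwardDiffᵇ ℓ)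

  rotateToPrime : Vec ℕ (suc m) → Vec ℕ (suc m)
  rotateToPrime e = Vec.map (suc ∘ rotate (split (toList e))) e

  normalise : Vec ℕ (suc m) → Vec ℕ (suc m)
  normalise π = Vec.map (rotate (pred (head π)) ∘ pred) π

  inverseRotation : Vec ℕ (suc m) → ℕ
  inverseRotation π = (m ∸ pred (head π)) % m

  InRange : ℕ → Set
  InRange x = 1 ≤ x × x < suc m

  ∈-walks⇒bounded : ∀ {S : Subset m} {e} → e ∈ walks 0 S → VecAll.All (_< m) e
  ∈-walks⇒bounded {S} {x ∷ e} e∈ with ∈-walks⁻ {S = S} e∈
  ... | refl , bounded , _ = z<s ∷ bounded

  rotateToPrime-prime : ∀ {S : Subset m} {e} → e ∈ walks 0 S → IsPrimeParkingFunction (toList (rotateToPrime e))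
  rotateToPrime-prime {S} {e} e∈ = subst IsPrimeParkingFunction (sym (Vec.toList-map _ e))
    (split-prime (VecAll.toList⁺ (∈-walks⇒bounded {S} e∈)) (Vec.length-toList e))

  Set-ℓ-rotateToPrime : ∀ {S : Subset m} {e} → e ∈ walks 0 S → Set-ℓ ℓ (rotateToPrime e) ≡ S
  Set-ℓ-rotateToPrime {S} {e} e∈ = trans (Set-ℓ≡adjacent _)
    (trans (adjacent-map (forwardDiffᵇ-rotate ℓ (split (toList e))) e) (proj₂ (proj₂ (∈-walks⁻ {S = S} e∈))))

  normalise-rotateToPrime : ∀ {S : Subset m} {e} → e ∈ walks 0 S → normalise (rotateToPrime e) ≡ e
  normalise-rotateToPrime {S} {x ∷ e} e∈ with ∈-walks⁻ {S = S} e∈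
  ... | refl , _ , _ = trans (sym (Vec.map-∘ _ _ (0 ∷ e)))
    (map-id-localᵛ (VecAll.map (rotate-inverse split<m′) (VecAll.toList⁻ bounded)))
    where
    bounded = VecAll.toList⁺ (∈-walks⇒bounded {S} e∈)
    split<m′ = split<m bounded (Vec.length-toList (0 ∷ e))

  pred<m : ∀ {x} → InRange x → pred x < m
  pred<m {suc x} (_ , s≤s x<m) = x<m

  prime⇒inRange : ∀ {π} → IsPrimeParkingFunction (toList π) → VecAll.All InRange π
  prime⇒inRange {π} prime = VecAll.zip (VecAll.toList⁻ (proj₁ (proj₁ prime)) ,
    VecAll.toList⁻ (primeCounts⇒bounded (Vec.length-toList π) (prime⇒primeCounts (Vec.length-toList π) prime)))

  rotate-normalise : ∀ {π} → VecAll.All InRange π →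
                     Vec.map (suc ∘ rotate (inverseRotation π)) (normalise π) ≡ π
  rotate-normalise {π@(x ∷ _)} inRange@(x∈range ∷ _) =
    trans (sym (Vec.map-∘ _ _ π)) (map-id-localᵛ (VecAll.map undo inRange))
    where
    undo : ∀ {z} → InRange z → suc (rotate (inverseRotation π) (rotate (pred x) (pred z))) ≡ z
    undo {suc z} z∈range = cong suc (rotate-inverse (pred<m x∈range) (pred<m z∈range))

  prime⇒normalise∈walks : ∀ {S π} → IsPrimeParkingFunction (toList π) → Set-ℓ ℓ π ≡ S →
                          normalise π ∈ walks 0 S
  prime⇒normalise∈walks {S} {π@(x ∷ rest)} prime Set-ℓπ≡S =
    subst (λ a → normalise π ∈ walks a S) (rotate-self (<⇒≤ (pred<m x∈range)))
      (∈-walks⁺ (normalise π) (VecAll.map⁺ (VecAll.universal (λ z → rotate<m (pred x) (pred z)) rest)) labels)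
    where
    open ≡-Reasoning
    inRange = prime⇒inRange {π} prime
    x∈range = VecAll.head inRange
    labels : adjacent (forwardDiffᵇ ℓ) (normalise π) ≡ S
    labels = begin
      adjacent (forwardDiffᵇ ℓ) (normalise π)
        ≡⟨ adjacent-map (forwardDiffᵇ-rotate ℓ (inverseRotation π)) (normalise π) ⟨
      adjacent (forwardDiffᵇ ℓ) (Vec.map (suc ∘ rotate (inverseRotation π)) (normalise π))
        ≡⟨ cong (adjacent (forwardDiffᵇ ℓ)) (rotate-normalise inRange) ⟩
      adjacent (forwardDiffᵇ ℓ) π  ≡⟨ Set-ℓ≡adjacent π ⟨
      Set-ℓ ℓ π                    ≡⟨ Set-ℓπ≡S ⟩
      S                            ∎

  rotateToPrime-normalise : ∀ {π} → IsPrimeParkingFunction (toList π) → rotateToPrime (normalise π) ≡ π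
  rotateToPrime-normalise {π} prime =
    trans (cong (λ c → Vec.map (suc ∘ rotate c) (normalise π)) split≡inverseRotation) (rotate-normalise inRange)
    where
    inRange = prime⇒inRange {π} prime
    bounded : All (_< m) (toList (normalise π))
    bounded = VecAll.toList⁺ (VecAll.map⁺ (VecAll.universal (λ z → rotate<m (pred (head π)) (pred z)) π))
    prime′ : IsPrimeParkingFunction (map (suc ∘ rotate (inverseRotation π)) (toList (normalise π)))
    prime′ = subst IsPrimeParkingFunction
      (trans (cong toList (sym (rotate-normalise inRange))) (Vec.toList-map _ (normalise π))) prime
    split≡inverseRotation : split (toList (normalise π)) ≡ inverseRotation π
    split≡inverseRotation =
      prime⇒split bounded (Vec.length-toList (normalise π)) (m%n<n (m ∸ pred (head π)) m) prime′

  enumeration : Subset m → List (Vec ℕ (suc m))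
  enumeration S = map rotateToPrime (walks 0 S)

  ∈-enumeration⇔ : ∀ S π → π ∈ enumeration S ⇔ (IsPrimeParkingFunction (toList π) × Set-ℓ ℓ π ≡ S)
  ∈-enumeration⇔ S π = mk⇔ sound complete
    where
    sound : π ∈ enumeration S → IsPrimeParkingFunction (toList π) × Set-ℓ ℓ π ≡ S
    sound π∈ with ∈-map⁻ rotateToPrime π∈
    ... | e , e∈ , refl = rotateToPrime-prime {S} e∈ , Set-ℓ-rotateToPrime e∈
    complete : IsPrimeParkingFunction (toList π) × Set-ℓ ℓ π ≡ S → π ∈ enumeration S
    complete (prime , Set-ℓπ≡S) = subst (_∈ enumeration S) (rotateToPrime-normalise prime)
      (∈-map⁺ rotateToPrime (prime⇒normalise∈walks prime Set-ℓπ≡S))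

  enumeration-unique : ∀ S → Unique (enumeration S)
  enumeration-unique S = Unique.map⁻ (subst Unique (sym normalise-enumeration) (walks-unique successors-unique 0 S))
    where
    normalise-enumeration : map normalise (enumeration S) ≡ walks 0 S
    normalise-enumeration = trans (sym (map-∘ (walks 0 S))) (map-id-local (All.tabulate (normalise-rotateToPrime {S})))

  length-enumeration : ∀ S → length (enumeration S) ≡ k ^ (m ∸ ∣ S ∣)
  length-enumeration S = begin
    length (enumeration S)             ≡⟨ length-map rotateToPrime (walks 0 S) ⟩
    length (walks 0 S)                 ≡⟨ length-walks (λ _ → refl) length-successors-false 0 S ⟩
    1 ^ ∣ S ∣ * k ^ (m ∸ ∣ S ∣)        ≡⟨ cong (_* k ^ (m ∸ ∣ S ∣)) (^-zeroˡ ∣ S ∣) ⟩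
    1 * k ^ (m ∸ ∣ S ∣)                ≡⟨ *-identityˡ _ ⟩
    k ^ (m ∸ ∣ S ∣)                    ∎
    where open ≡-Reasoning

theorem6p1 : (k ℓ : ℕ) → ℓ ≤ k → (S : Subset (suc k)) →
    Σ (List (Vec ℕ (suc (suc k)))) λ L →
      Unique L ×
      ((π : Vec ℕ (suc (suc k))) →
        (π ∈ L) ⇔ (IsPrimeParkingFunction (toList π) × Set-ℓ ℓ π ≡ S)) ×
      (length L ≡ k ^ (suc k ∸ ∣ S ∣))
theorem6p1 k ℓ _ S = enumeration S , enumeration-unique S , ∈-enumeration⇔ S , length-enumeration S
  where
  open Enumeration k ℓ
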